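{- There exist additive complements $A$ and $B$ such that $$\limsup_{x\to+\infty}\frac{A(x)B(x)}{x}=2$$ and $A(x)B(x)-x=1$ for infinitely many positive integers $x$.
   Context: Two infinite sequences (sets) $A$ and $B$ of non-negative integers are called additive complements if their sumset $A+B=\{a+b: a\in A,\ b\in B\}$ contains all sufficiently large integers. For a set $S$ of non-negative integers, its counting function is $S(x)=\#\{s\in S: s\le x\}$. -}

module Defs where

open import Data.Nat using (ℕ; zero; suc; _+_; _*_; _≤_; _<_)
open import Data.Bool using (Bool; true; false)
open import Data.Product using (Σ; _×_; ∃; ∃-syntax)
open import Relation.Binary.PropositionalEquality using (_≡_)

NatSet : Set
NatSet = ℕ → Bool

_∈ˢ_ : ℕ → NatSet → Set
n ∈ˢ S = S n ≡ true

Infinite : NatSet → Set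
Infinite S = ∀ N → ∃[ s ] (N ≤ s × s ∈ˢ S)

count : NatSet → ℕ → ℕ
count S zero with S zero
... | true  = 1
... | false = 0
count S (suc x) with S (suc x)
... | true  = suc (count S x)
... | false = count S x

SumsetCofinite : NatSet → NatSet → Set
SumsetCofinite A B = ∃[ N₀ ] (∀ n → N₀ ≤ n → ∃[ a ] ∃[ b ] (a ∈ˢ A × b ∈ˢ B × a + b ≡ n))

AdditiveComplements : NatSet → NatSet → Set
AdditiveComplements A B = Infinite A × Infinite B × SumsetCofinite A B

-- limsup_{x→∞} f(x)/x = 2, stated via rational ε = 1/k (k ≥ 1):
--   (i)  for every k ≥ 1, eventually f(x)/x < 2 + 1/k, i.e. k·f(x) < (2k+1)·x;
--   (ii) for every k ≥ 1, for infinitely many x, f(x)/x > 2 − 1/k, i.e. k·f(x) > (2k−1)·x,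
--        written without subtraction as k·f(x) + x > 2k·x.
LimsupRatioIsTwo : (ℕ → ℕ) → Set
LimsupRatioIsTwo f =
  (∀ k → 1 ≤ k → ∃[ N ] (∀ x → N ≤ x → k * f x < (2 * k + 1) * x))
  × (∀ k → 1 ≤ k → ∀ N → ∃[ x ] (N ≤ x × 1 ≤ x × 2 * k * x < k * f x + x))

-- Let A be the numbers all of whose binary digits 1 sit at square positions and B those whose
-- digits 1 sit at non-square positions. Sorting the digits of n splits it as a + b with a ∈ A,
-- b ∈ B, and below 2^m the two counts are 2^(#squares < m) and 2^(#non-squares < m), whose
-- product is exactly 2^m. Hence A(x)B(x) = x + 1 at x = 2^m − 1, and A(x)B(x) ≤ 2x always.
-- If m is a square preceded by a long run q, …, m − 1 of non-squares, then at x = 2^m + 2^q − 1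
-- the count of A has doubled since 2^m − 1 while that of B has not changed, so
-- A(x)B(x) ≥ 2·2^m ≈ 2x.
module Submission where

open import Defs
open import Data.Bool using (Bool; true; false; not; _∧_; if_then_else_)
open import Data.Fin using (Fin; toℕ; fromℕ<)
open import Data.Fin.Properties using (any?; toℕ-fromℕ<)
open import Data.Nat using (ℕ; zero; suc; pred; >-nonZero; _+_; _*_; _∸_; _^_; _≤_; _<_; _≤′_; ≤′-refl; ≤′-step; z≤n; s≤s; _≟_; _<?_; _≤?_)
open import Data.Nat.Properties
open import Algebra.Properties.CommutativeSemigroup +-commutativeSemigroup using (x∙yz≈y∙xz; xy∙z≈xz∙y)
open import Data.Nat.Tactic.RingSolver using (solve-∀)
open import Data.Product using (∃; ∃-syntax; _×_; _,_)
open import Data.Sum using (inj₁; inj₂)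
open import Function using (_∘_)
open import Relation.Nullary using (¬_; yes; no; does; contradiction)
open import Relation.Nullary.Decidable using (dec-true; dec-false)
open import Relation.Binary.PropositionalEquality

n<2^n : ∀ n → n < 2 ^ n
n<2^n zero    = s≤s z≤n
n<2^n (suc n) = +-mono-≤-< (m^n>0 2 n) (≤-trans (n<2^n n) (m≤m+n _ 0))

2^[1+m]≡2^m+2^m : ∀ m → 2 ^ suc m ≡ 2 ^ m + 2 ^ m
2^[1+m]≡2^m+2^m m = cong (2 ^ m +_) (+-identityʳ (2 ^ m))

suc-pred[2^m] : ∀ m → suc (pred (2 ^ m)) ≡ 2 ^ m
suc-pred[2^m] m = suc-pred (2 ^ m) {{>-nonZero (m^n>0 2 m)}}

i≤pred[2^m]⇒i<2^m : ∀ {i} m → i ≤ pred (2 ^ m) → i < 2 ^ m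
i≤pred[2^m]⇒i<2^m m i≤ = subst (_ <_) (suc-pred[2^m] m) (s≤s i≤)

pred[2^m]+2^m≡pred[2^[1+m]] : ∀ m → pred (2 ^ m) + 2 ^ m ≡ pred (2 ^ suc m)
pred[2^m]+2^m≡pred[2^[1+m]] m =
  cong pred (trans (cong (_+ 2 ^ m) (suc-pred[2^m] m)) (sym (2^[1+m]≡2^m+2^m m)))

-- n ∈ digitsIn D iff every position of a binary digit 1 of n lies in D.
-- digitsBelowIn D m n reads only the m lowest digits of n, so it is meaningful for n < 2 ^ m.
digitsBelowIn : (ℕ → Bool) → ℕ → ℕ → Bool
digitsBelowIn D zero    n = true
digitsBelowIn D (suc m) n =
  if does (n <? 2 ^ m) then digitsBelowIn D m n else D m ∧ digitsBelowIn D m (n ∸ 2 ^ m)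

digitsIn : (ℕ → Bool) → NatSet
digitsIn D n = digitsBelowIn D n n

module _ (D : ℕ → Bool) where

  digitsBelowIn-<2^ : ∀ {m n} → n < 2 ^ m → digitsBelowIn D (suc m) n ≡ digitsBelowIn D m n
  digitsBelowIn-<2^ {m} {n} n<2^m rewrite dec-true (n <? 2 ^ m) n<2^m = refl

  digitsBelowIn-≥2^ : ∀ {m n} → 2 ^ m ≤ n → digitsBelowIn D (suc m) n ≡ D m ∧ digitsBelowIn D m (n ∸ 2 ^ m)
  digitsBelowIn-≥2^ {m} {n} 2^m≤n rewrite dec-false (n <? 2 ^ m) (≤⇒≯ 2^m≤n) = refl

  digitsBelowIn-stable : ∀ {m m′ n} → n < 2 ^ m → m ≤ m′ → digitsBelowIn D m′ n ≡ digitsBelowIn D m n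
  digitsBelowIn-stable {m} {n = n} n<2^m m≤m′ = go (≤⇒≤′ m≤m′)
    where
    go : ∀ {m′} → m ≤′ m′ → digitsBelowIn D m′ n ≡ digitsBelowIn D m n
    go ≤′-refl = refl
    go (≤′-step {m′} m≤′m′) = trans (digitsBelowIn-<2^ {m′} (<-≤-trans n<2^m (^-monoʳ-≤ 2 (≤′⇒≤ m≤′m′)))) (go m≤′m′)

  digitsIn≡digitsBelowIn : ∀ {m n} → n < 2 ^ m → digitsIn D n ≡ digitsBelowIn D m n
  digitsIn≡digitsBelowIn {m} {n} n<2^m with ≤-total m n
  ... | inj₁ m≤n = digitsBelowIn-stable n<2^m m≤n
  ... | inj₂ n≤m = sym (digitsBelowIn-stable (n<2^n n) n≤m)

  digitsIn-+2^ : ∀ {i} m → i < 2 ^ m → digitsIn D (i + 2 ^ m) ≡ D m ∧ digitsIn D i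
  digitsIn-+2^ {i} m i<2^m = begin
    digitsIn D (i + 2 ^ m)                                   ≡⟨ digitsIn≡digitsBelowIn {suc m} i+2^m<2^[1+m] ⟩
    digitsBelowIn D (suc m) (i + 2 ^ m)                      ≡⟨ digitsBelowIn-≥2^ (m≤n+m (2 ^ m) i) ⟩
    D m ∧ digitsBelowIn D m (i + 2 ^ m ∸ 2 ^ m)              ≡⟨ cong (λ j → D m ∧ digitsBelowIn D m j) (m+n∸n≡m i (2 ^ m)) ⟩
    D m ∧ digitsBelowIn D m i                                ≡⟨ cong (D m ∧_) (digitsIn≡digitsBelowIn {m} i<2^m) ⟨
    D m ∧ digitsIn D i                                       ∎
    where
    open ≡-Reasoning
    i+2^m<2^[1+m] : i + 2 ^ m < 2 ^ suc m
    i+2^m<2^[1+m] = subst (i + 2 ^ m <_) (sym (2^[1+m]≡2^m+2^m m)) (+-monoˡ-< (2 ^ m) i<2^m)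

indicator : Bool → ℕ
indicator true  = 1
indicator false = 0

count-zero : ∀ X → count X 0 ≡ indicator (X 0)
count-zero X with X 0
... | true  = refl
... | false = refl

count-suc : ∀ X x → count X (suc x) ≡ indicator (X (suc x)) + count X x
count-suc X x with X (suc x)
... | true  = refl
... | false = refl

count-mono : ∀ X {x y} → x ≤ y → count X x ≤ count X y
count-mono X {x} x≤y = go (≤⇒≤′ x≤y)
  where
  go : ∀ {y} → x ≤′ y → count X x ≤ count X y
  go ≤′-refl             = ≤-refl
  go (≤′-step {y} x≤′y) = ≤-trans (go x≤′y) (subst (count X y ≤_) (sym (count-suc X y)) (m≤n+m _ _))

count-translate : ∀ (X Y : NatSet) M y → (∀ i → i ≤ y → X (i + suc M) ≡ Y i) →
                  count X (y + suc M) ≡ count X M + count Y y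
count-translate X Y M zero X≡Y = begin
  count X (suc M)                   ≡⟨ count-suc X M ⟩
  indicator (X (suc M)) + count X M ≡⟨ cong (λ b → indicator b + count X M) (X≡Y 0 z≤n) ⟩
  indicator (Y 0) + count X M       ≡⟨ +-comm _ (count X M) ⟩
  count X M + indicator (Y 0)       ≡⟨ cong (count X M +_) (count-zero Y) ⟨
  count X M + count Y 0             ∎
  where open ≡-Reasoning
count-translate X Y M (suc y) X≡Y = begin
  count X (suc (y + suc M))                                   ≡⟨ count-suc X (y + suc M) ⟩
  indicator (X (suc y + suc M)) + count X (y + suc M)         ≡⟨ cong₂ (λ b n → indicator b + n) (X≡Y (suc y) ≤-refl)
                                                                        (count-translate X Y M y (λ i i≤y → X≡Y i (m≤n⇒m≤1+n i≤y))) ⟩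
  indicator (Y (suc y)) + (count X M + count Y y)             ≡⟨ x∙yz≈y∙xz (indicator (Y (suc y))) (count X M) (count Y y) ⟩
  count X M + (indicator (Y (suc y)) + count Y y)             ≡⟨ cong (count X M +_) (count-suc Y y) ⟨
  count X M + count Y (suc y)                                 ∎
  where open ≡-Reasoning

count-beyond-2^ : ∀ (X Y : NatSet) m y → (∀ i → i ≤ y → X (i + 2 ^ m) ≡ Y i) →
                  count X (y + 2 ^ m) ≡ count X (pred (2 ^ m)) + count Y y
count-beyond-2^ X Y m y X≡Y =
  subst (λ n → count X (y + n) ≡ count X (pred (2 ^ m)) + count Y y) (suc-pred[2^m] m)
    (count-translate X Y (pred (2 ^ m)) y
      (λ i i≤y → subst (λ n → X (i + n) ≡ Y i) (sym (suc-pred[2^m] m)) (X≡Y i i≤y)))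

count-empty : ∀ y → count (λ _ → false) y ≡ 0
count-empty zero    = refl
count-empty (suc y) = count-empty y

digitCount : (ℕ → Bool) → ℕ → ℕ
digitCount D m = count (digitsIn D) (pred (2 ^ m))

digitCount-suc : ∀ D m → digitCount D (suc m) ≡ digitCount D m + count (λ i → D m ∧ digitsIn D i) (pred (2 ^ m))
digitCount-suc D m = begin
  count (digitsIn D) (pred (2 ^ suc m))     ≡⟨ cong (count (digitsIn D)) (pred[2^m]+2^m≡pred[2^[1+m]] m) ⟨
  count (digitsIn D) (pred (2 ^ m) + 2 ^ m) ≡⟨ count-beyond-2^ (digitsIn D) _ m (pred (2 ^ m))
                                                 (λ i i≤ → digitsIn-+2^ D m (i≤pred[2^m]⇒i<2^m m i≤)) ⟩
  digitCount D m + count (λ i → D m ∧ digitsIn D i) (pred (2 ^ m)) ∎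
  where open ≡-Reasoning

digitCount-suc-∈ : ∀ D m → D m ≡ true → digitCount D (suc m) ≡ digitCount D m + digitCount D m
digitCount-suc-∈ D m Dm≡true = begin
  digitCount D (suc m)                                             ≡⟨ digitCount-suc D m ⟩
  digitCount D m + count (λ i → D m ∧ digitsIn D i) (pred (2 ^ m))
    ≡⟨ cong (λ b → digitCount D m + count (λ i → b ∧ digitsIn D i) (pred (2 ^ m))) Dm≡true ⟩
  digitCount D m + digitCount D m                                  ∎
  where open ≡-Reasoning

digitCount-suc-∉ : ∀ D m → D m ≡ false → digitCount D (suc m) ≡ digitCount D m
digitCount-suc-∉ D m Dm≡false = begin
  digitCount D (suc m)                                             ≡⟨ digitCount-suc D m ⟩
  digitCount D m + count (λ i → D m ∧ digitsIn D i) (pred (2 ^ m))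
    ≡⟨ cong (λ b → digitCount D m + count (λ i → b ∧ digitsIn D i) (pred (2 ^ m))) Dm≡false ⟩
  digitCount D m + count (λ _ → false) (pred (2 ^ m))              ≡⟨ cong (digitCount D m +_) (count-empty (pred (2 ^ m))) ⟩
  digitCount D m + 0                                               ≡⟨ +-identityʳ _ ⟩
  digitCount D m                                                   ∎
  where open ≡-Reasoning

digitCount*digitCount-complement : ∀ D m → digitCount D m * digitCount (not ∘ D) m ≡ 2 ^ m
digitCount*digitCount-complement D zero = refl
digitCount*digitCount-complement D (suc m) with D m in Dm
... | true = begin
  digitCount D (suc m) * digitCount (not ∘ D) (suc m) ≡⟨ cong₂ _*_ (digitCount-suc-∈ D m Dm) (digitCount-suc-∉ (not ∘ D) m (cong not Dm)) ⟩
  (a + a) * b                                         ≡⟨ *-distribʳ-+ b a a ⟩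
  a * b + a * b                                       ≡⟨ cong₂ _+_ IH IH ⟩
  2 ^ m + 2 ^ m                                       ≡⟨ 2^[1+m]≡2^m+2^m m ⟨
  2 ^ suc m                                           ∎
  where
  open ≡-Reasoning
  a = digitCount D m
  b = digitCount (not ∘ D) m
  IH = digitCount*digitCount-complement D m
... | false = begin
  digitCount D (suc m) * digitCount (not ∘ D) (suc m) ≡⟨ cong₂ _*_ (digitCount-suc-∉ D m Dm) (digitCount-suc-∈ (not ∘ D) m (cong not Dm)) ⟩
  a * (b + b)                                         ≡⟨ *-distribˡ-+ a b b ⟩
  a * b + a * b                                       ≡⟨ cong₂ _+_ IH IH ⟩
  2 ^ m + 2 ^ m                                       ≡⟨ 2^[1+m]≡2^m+2^m m ⟨
  2 ^ suc m                                           ∎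
  where
  open ≡-Reasoning
  a = digitCount D m
  b = digitCount (not ∘ D) m
  IH = digitCount*digitCount-complement D m

digitCount-constant : ∀ D q d → (∀ t → q ≤ t → t < d + q → D t ≡ false) → digitCount D (d + q) ≡ digitCount D q
digitCount-constant D q zero    _      = refl
digitCount-constant D q (suc d) D≡false =
  trans (digitCount-suc-∉ D (d + q) (D≡false (d + q) (m≤n+m q d) ≤-refl))
        (digitCount-constant D q d (λ t q≤t t<d+q → D≡false t q≤t (m≤n⇒m≤1+n t<d+q)))

digitsIn-decompose : ∀ D m n → n < 2 ^ m → ∃[ a ] ∃[ b ] (a ∈ˢ digitsIn D × b ∈ˢ digitsIn (not ∘ D) × a + b ≡ n)
digitsIn-decompose D zero    zero    _ = 0 , 0 , refl , refl , refl
digitsIn-decompose D zero    (suc n) (s≤s ())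
digitsIn-decompose D (suc m) n       n<2^[1+m] with n <? 2 ^ m
... | yes n<2^m = digitsIn-decompose D m n n<2^m
... | no  n≮2^m = extend (digitsIn-decompose D m r r<2^m)
  where
  r = n ∸ 2 ^ m
  r+2^m≡n : r + 2 ^ m ≡ n
  r+2^m≡n = m∸n+n≡m (≮⇒≥ n≮2^m)
  r<2^m : r < 2 ^ m
  r<2^m = +-cancelʳ-< (2 ^ m) r (2 ^ m) (subst₂ _<_ (sym r+2^m≡n) (2^[1+m]≡2^m+2^m m) n<2^[1+m])
  extend : ∃[ a ] ∃[ b ] (a ∈ˢ digitsIn D × b ∈ˢ digitsIn (not ∘ D) × a + b ≡ r) →
           ∃[ a ] ∃[ b ] (a ∈ˢ digitsIn D × b ∈ˢ digitsIn (not ∘ D) × a + b ≡ n)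
  extend (a , b , a∈ , b∈ , a+b≡r) with D m in Dm
  ... | true  = a + 2 ^ m , b ,
                trans (digitsIn-+2^ D m a<2^m) (cong₂ _∧_ Dm a∈) , b∈ ,
                trans (xy∙z≈xz∙y a (2 ^ m) b) (trans (cong (_+ 2 ^ m) a+b≡r) r+2^m≡n)
    where a<2^m = ≤-<-trans (subst (a ≤_) a+b≡r (m≤m+n a b)) r<2^m
  ... | false = a , b + 2 ^ m , a∈ ,
                trans (digitsIn-+2^ (not ∘ D) m b<2^m) (cong₂ _∧_ (cong not Dm) b∈) ,
                trans (sym (+-assoc a b (2 ^ m))) (trans (cong (_+ 2 ^ m) a+b≡r) r+2^m≡n)
    where b<2^m = ≤-<-trans (subst (b ≤_) a+b≡r (m≤n+m b a)) r<2^m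

Unbounded : (ℕ → Bool) → Set
Unbounded D = ∀ N → ∃[ m ] (N ≤ m × D m ≡ true)

HasLongGaps : (ℕ → Bool) → Set
HasLongGaps D = ∀ g N → ∃[ q ] ∃[ d ] (N ≤ q × g ≤ d × D (d + q) ≡ true × (∀ t → q ≤ t → t < d + q → D t ≡ false))

longGaps⇒unbounded : ∀ {D} → HasLongGaps D → Unbounded D
longGaps⇒unbounded gaps N with gaps 0 N
... | q , d , N≤q , _ , Dd+q≡true , _ = d + q , ≤-trans N≤q (m≤n+m q d) , Dd+q≡true

longGaps⇒unbounded-not : ∀ {D} → HasLongGaps D → Unbounded (not ∘ D)
longGaps⇒unbounded-not gaps N with gaps 1 N
... | q , d , N≤q , 1≤d , _ , gap = q , N≤q , cong not (gap q ≤-refl (m<n+m q 1≤d))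

digitsIn-infinite : ∀ D → Unbounded D → Infinite (digitsIn D)
digitsIn-infinite D unbounded N with unbounded N
... | m , N≤m , Dm≡true =
  2 ^ m , ≤-trans N≤m (<⇒≤ (n<2^n m)) , trans (digitsIn-+2^ D m (m^n>0 2 m)) (cong (_∧ true) Dm≡true)

digitsIn-sumset : ∀ D → SumsetCofinite (digitsIn D) (digitsIn (not ∘ D))
digitsIn-sumset D = 0 , λ n _ → digitsIn-decompose D n n (n<2^n n)

c*pred[2^q]<2^[d+q] : ∀ c d q → 1 ≤ c → c ≤ d → c * pred (2 ^ q) < 2 ^ (d + q)
c*pred[2^q]<2^[d+q] c d q 1≤c c≤d = begin-strict
  c * pred (2 ^ q) <⟨ *-monoʳ-< c {{>-nonZero 1≤c}} (i≤pred[2^m]⇒i<2^m q ≤-refl) ⟩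
  c * 2 ^ q        ≤⟨ *-monoˡ-≤ (2 ^ q) (≤-trans c≤d (<⇒≤ (n<2^n d))) ⟩
  2 ^ d * 2 ^ q    ≡⟨ ^-distribˡ-+-* 2 d q ⟨
  2 ^ (d + q)      ∎
  where open ≤-Reasoning

-- Cleared of denominators: 2kY < X and F ≥ 2X give F / (Y + X) > 2 − 1/k.
ratio-near-two : ∀ k X Y F → 2 * k * Y < X → X + X ≤ F → 2 * k * (Y + X) < k * F + (Y + X)
ratio-near-two k X Y F 2kY<X 2X≤F = begin-strict
  2 * k * (Y + X)         ≡⟨ distrib k X Y ⟩
  2 * k * Y + k * (X + X) <⟨ +-monoˡ-< (k * (X + X)) 2kY<X ⟩
  X + k * (X + X)         ≤⟨ +-mono-≤ (m≤n+m X Y) (*-monoʳ-≤ k 2X≤F) ⟩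
  (Y + X) + k * F         ≡⟨ +-comm (Y + X) (k * F) ⟩
  k * F + (Y + X)         ∎
  where
  open ≤-Reasoning
  distrib : ∀ k X Y → 2 * k * (Y + X) ≡ 2 * k * Y + k * (X + X)
  distrib = solve-∀

countProduct : (ℕ → Bool) → ℕ → ℕ
countProduct D x = count (digitsIn D) x * count (digitsIn (not ∘ D)) x

module _ (D : ℕ → Bool) where

  countProduct-mono : ∀ {x y} → x ≤ y → countProduct D x ≤ countProduct D y
  countProduct-mono x≤y = *-mono-≤ (count-mono (digitsIn D) x≤y) (count-mono (digitsIn (not ∘ D)) x≤y)

  countProduct≤2x : ∀ {x} → 1 ≤ x → countProduct D x ≤ 2 * x
  countProduct≤2x {x} 1≤x = go x (n<2^n x)
    where
    go : ∀ m → x < 2 ^ m → countProduct D x ≤ 2 * x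
    go zero    x<1 = contradiction 1≤x (<⇒≱ x<1)
    go (suc m) x<2^[1+m] with x <? 2 ^ m
    ... | yes x<2^m = go m x<2^m
    ... | no  x≮2^m = begin
      countProduct D x                    ≤⟨ countProduct-mono (≤-pred (subst (x <_) (sym (suc-pred[2^m] (suc m))) x<2^[1+m])) ⟩
      countProduct D (pred (2 ^ suc m))   ≡⟨ digitCount*digitCount-complement D (suc m) ⟩
      2 ^ m + (2 ^ m + 0)                 ≤⟨ +-mono-≤ 2^m≤x (+-monoˡ-≤ 0 2^m≤x) ⟩
      2 * x                               ∎
      where
      open ≤-Reasoning
      2^m≤x = ≮⇒≥ x≮2^m

  countProduct-after-gap : ∀ q d → D (d + q) ≡ true → (∀ t → q ≤ t → t < d + q → D t ≡ false) →
                           2 ^ (d + q) + 2 ^ (d + q) ≤ countProduct D (pred (2 ^ q) + 2 ^ (d + q))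
  countProduct-after-gap q d Dm≡true gap = begin
    2 ^ m + 2 ^ m                          ≡⟨ cong₂ _+_ ab≡2^m ab≡2^m ⟨
    a * b + a * b                          ≡⟨ *-distribʳ-+ b a a ⟨
    (a + a) * b                            ≤⟨ *-monoʳ-≤ (a + a) (count-mono (digitsIn (not ∘ D)) pred[2^m]≤x) ⟩
    (a + a) * count (digitsIn (not ∘ D)) x ≡⟨ cong (_* count (digitsIn (not ∘ D)) x) countA≡a+a ⟨
    countProduct D x                       ∎
    where
    open ≤-Reasoning
    m = d + q
    x = pred (2 ^ q) + 2 ^ m
    a = digitCount D m
    b = digitCount (not ∘ D) m
    ab≡2^m : a * b ≡ 2 ^ m
    ab≡2^m = digitCount*digitCount-complement D m
    pred[2^m]≤x : pred (2 ^ m) ≤ x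
    pred[2^m]≤x = ≤-trans pred[n]≤n (m≤n+m (2 ^ m) (pred (2 ^ q)))
    upper-copy : ∀ i → i ≤ pred (2 ^ q) → digitsIn D (i + 2 ^ m) ≡ digitsIn D i
    upper-copy i i≤ = trans (digitsIn-+2^ D m i<2^m) (cong (_∧ digitsIn D i) Dm≡true)
      where i<2^m = <-≤-trans (i≤pred[2^m]⇒i<2^m q i≤) (^-monoʳ-≤ 2 (m≤n+m q d))
    countA≡a+a : count (digitsIn D) x ≡ a + a
    countA≡a+a = trans (count-beyond-2^ (digitsIn D) (digitsIn D) m (pred (2 ^ q)) upper-copy)
                       (cong (a +_) (sym (digitCount-constant D q d gap)))

  countProduct≡x+1-infinitely-often : ∀ N → ∃[ x ] (N ≤ x × 1 ≤ x × countProduct D x ≡ x + 1)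
  countProduct≡x+1-infinitely-often N = x , ≤-trans (n≤1+n N) 1+N≤x , ≤-trans (s≤s z≤n) 1+N≤x , product≡x+1
    where
    x = pred (2 ^ suc N)
    1+N≤x : suc N ≤ x
    1+N≤x = ≤-pred (subst (suc N <_) (sym (suc-pred[2^m] (suc N))) (n<2^n (suc N)))
    product≡x+1 : countProduct D x ≡ x + 1
    product≡x+1 = trans (digitCount*digitCount-complement D (suc N))
                        (trans (sym (suc-pred[2^m] (suc N))) (+-comm 1 x))

  countProduct-limsup-≤2 : ∀ k → 1 ≤ k → ∃[ N ] (∀ x → N ≤ x → k * countProduct D x < (2 * k + 1) * x)
  countProduct-limsup-≤2 k _ = 1 , λ x 1≤x → begin-strict
    k * countProduct D x ≤⟨ *-monoʳ-≤ k (countProduct≤2x 1≤x) ⟩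
    k * (2 * x)          <⟨ m<m+n (k * (2 * x)) 1≤x ⟩
    k * (2 * x) + x      ≡⟨ distrib k x ⟩
    (2 * k + 1) * x      ∎
    where
    open ≤-Reasoning
    distrib : ∀ k x → k * (2 * x) + x ≡ (2 * k + 1) * x
    distrib = solve-∀

  countProduct-limsup-≥2 : HasLongGaps D → ∀ k → 1 ≤ k → ∀ N → ∃[ x ] (N ≤ x × 1 ≤ x × 2 * k * x < k * countProduct D x + x)
  countProduct-limsup-≥2 gaps k 1≤k N with gaps (2 * k) N
  ... | q , d , N≤q , 2k≤d , Dd+q≡true , gap =
    x , ≤-trans N≤q (≤-trans (m≤n+m q d) (≤-trans (<⇒≤ (n<2^n (d + q))) 2^[d+q]≤x)) ,
    ≤-trans (m^n>0 2 (d + q)) 2^[d+q]≤x ,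
    ratio-near-two k (2 ^ (d + q)) (pred (2 ^ q)) (countProduct D x)
      (c*pred[2^q]<2^[d+q] (2 * k) d q (≤-trans 1≤k (m≤m+n k _)) 2k≤d)
      (countProduct-after-gap q d Dd+q≡true gap)
    where
    x = pred (2 ^ q) + 2 ^ (d + q)
    2^[d+q]≤x = m≤n+m (2 ^ (d + q)) (pred (2 ^ q))

isSquare : ℕ → Bool
isSquare n = does (any? λ (j : Fin (suc n)) → toℕ j * toℕ j ≟ n)

n≤n*n : ∀ n → n ≤ n * n
n≤n*n zero      = z≤n
n≤n*n n@(suc _) = m≤m*n n n

isSquare-square : ∀ j → isSquare (j * j) ≡ true
isSquare-square j = dec-true (any? λ i → toℕ i * toℕ i ≟ j * j) (fromℕ< j<1+j*j , cong (λ i → i * i) (toℕ-fromℕ< j<1+j*j))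
  where j<1+j*j = s≤s (n≤n*n j)

isSquare-between : ∀ j t → j * j < t → t < suc j * suc j → isSquare t ≡ false
isSquare-between j t j²<t t<[1+j]² = dec-false (any? λ i → toℕ i * toℕ i ≟ t) not-square
  where
  not-square : ¬ ∃ λ (i : Fin (suc t)) → toℕ i * toℕ i ≡ t
  not-square (i , i²≡t) with toℕ i ≤? j
  ... | yes i≤j = <⇒≢ (≤-<-trans (*-mono-≤ i≤j i≤j) j²<t) i²≡t
  ... | no  i≰j = <⇒≢ (<-≤-trans t<[1+j]² (*-mono-≤ (≰⇒> i≰j) (≰⇒> i≰j))) (sym i²≡t)

squares-longGaps : HasLongGaps isSquare
squares-longGaps g N =
  suc (j * j) , j + j ,
  ≤-trans (m≤n+m N g) (≤-trans (n≤n*n j) (n≤1+n _)) ,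
  ≤-trans (m≤m+n g N) (m≤m+n j j) ,
  subst (λ m → isSquare m ≡ true) (sym (next-square j)) (isSquare-square (suc j)) ,
  λ t j²<t t<d+q → isSquare-between j t j²<t (subst (t <_) (next-square j) t<d+q)
  where
  j = g + N
  next-square : ∀ j → (j + j) + suc (j * j) ≡ suc j * suc j
  next-square = solve-∀

theorem1p1 : ∃[ A ] ∃[ B ] (AdditiveComplements A B
                 × LimsupRatioIsTwo (λ x → count A x * count B x)
                 × (∀ N → ∃[ x ] (N ≤ x × 1 ≤ x × count A x * count B x ≡ x + 1)))
theorem1p1 =
  digitsIn isSquare , digitsIn (not ∘ isSquare) ,
  ( digitsIn-infinite isSquare (longGaps⇒unbounded squares-longGaps)
  , digitsIn-infinite (not ∘ isSquare) (longGaps⇒unbounded-not squares-longGaps)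
  , digitsIn-sumset isSquare ) ,
  (countProduct-limsup-≤2 isSquare , countProduct-limsup-≥2 isSquare squares-longGaps) ,
  countProduct≡x+1-infinitely-often isSquare
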